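{- Let $p$ be a prime and $q\in\mathbb{C}_p$ with $|1-q|_p<1$. For $s\in\mathbb{N}$ and $m_1,\ldots,m_s,n_1,\ldots,n_s,k\in\mathbb{Z}_+$ with $m_1n_1+\cdots+m_sn_s>(m_1+\cdots+m_s)k+1$, $$\sum_{l=0}^{k\sum_{i=1}^s m_i}\binom{k\sum_{i=1}^s m_i}{l}(-1)^{k\sum_{i=1}^s m_i-l}\Big\{\Big(\sum_{i=1}^s m_in_i-l+1\Big)-q+q^2\beta_{n_1m_1+\cdots+n_sm_s-l,\frac{1}{q}}\Big\}$$ $$=\sum_{l=0}^{\sum_{i=1}^s n_im_i-k\sum_{i=1}^s m_i}\binom{\sum_{i=1}^s n_im_i-k\sum_{i=1}^s m_i}{l}(-1)^l\beta_{(m_1+\cdots+m_s)k+l,q}.$$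
   Context: $\mathbb{Z}_+=\mathbb{N}\cup\{0\}$. The Carlitz $q$-Bernoulli numbers are defined by $\beta_{0,q}=1$ and $q(q\beta+1)^k-\beta_{k,q}=1$ if $k=1$, $0$ if $k>1$, with the umbral convention of replacing $\beta^i$ by $\beta_{i,q}$ after binomial expansion; $\beta_{k,1/q}$ denotes the same numbers with $q$ replaced by $q^{ -1}$. -}

module Defs where

open import Level using (_⊔_)
open import Data.Nat using (ℕ; zero; suc; _≤_)
open import Data.Nat.Combinatorics using (_C_)
open import Data.Fin using (Fin)
import Data.Fin as Fin
open import Data.Product using (_×_; ∃)
open import Relation.Nullary using (¬_)
open import Algebra.Bundles using (CommutativeRing)

finSum : ∀ {s} → (Fin s → ℕ) → ℕ
finSum {zero}  f = 0
finSum {suc s} f = f Fin.zero Data.Nat.+ finSum (λ i → f (Fin.suc i))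

module _ {c ℓ} (R : CommutativeRing c ℓ) where
  open CommutativeRing R

  pow : Carrier → ℕ → Carrier
  pow x zero    = 1#
  pow x (suc n) = x * pow x n

  nat : ℕ → Carrier
  nat zero    = 0#
  nat (suc n) = 1# + nat n

  sign : ℕ → Carrier
  sign n = pow (- 1#) n

  sumTo : ℕ → (ℕ → Carrier) → Carrier
  sumTo zero    f = f 0
  sumTo (suc n) f = sumTo n f + f (suc n)

  δ₁ : ℕ → Carrier
  δ₁ (suc zero) = 1#
  δ₁ _          = 0#

  IsField : Set (c ⊔ ℓ)
  IsField = ¬ (1# ≈ 0#) × (∀ x → ¬ (x ≈ 0#) → ∃ λ y → x * y ≈ 1#)

  -- b is the sequence of Carlitz q-Bernoulli numbers β_{k,q}:
  -- β_0 = 1 and q (qβ+1)^k - β_k = δ_{k,1} for k ≥ 1 (umbral), i.e.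
  -- q * Σ_{j=0}^{k} C(k,j) q^j β_j - β_k = δ_{k,1}.
  IsCarlitz : Carrier → (ℕ → Carrier) → Set ℓ
  IsCarlitz q b =
    (b 0 ≈ 1#) ×
    (∀ k → 1 ≤ k →
       q * sumTo k (λ j → nat (k C j) * (pow q j * b j)) - b k ≈ δ₁ k)

module Submission where

-- Write alternatingSum a n = Σₗ C(n,l) (−1)ˡ aₗ and Uₙ = (qβ+1)ⁿ.  Binomial inversion gives
-- alternatingSum U n = (−1)ⁿ qⁿ βₙ, and as q Uₙ − βₙ is 0 for n ≥ 2, 1 for n = 1 and q − 1 for
-- n = 0, applying alternatingSum to the Carlitz recurrence yields
-- alternatingSum β n = (n + 1 − q) + q (−1)ⁿ qⁿ βₙ.  The sequence (−1)ⁿ qⁿ Uₙ satisfies the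
-- recurrence for q⁻¹, whose solution is unique because no power of q⁻¹ is 1; hence
-- β_{n,1/q} = (−1)ⁿ qⁿ Uₙ, and for x ≥ 2 the braced term of the theorem at x is alternatingSum β x.
-- Finally a K-fold alternating binomial combination of alternatingSum β, taken around X, is
-- alternatingSum of the shifted sequence β_{K+l} at X − K.

open import Defs
open import Data.Nat using (ℕ; zero; suc; z≤n; s≤s; _≤_; _<_; _∸_)
import Data.Nat as ℕ
import Data.Nat.Properties as ℕₚ
open import Data.Nat.Combinatorics using (_C_; nCn≡1; nCk+nC[k+1]≡[n+1]C[k+1]; k>n⇒nCk≡0)
open import Data.Fin using (Fin)
import Data.Fin as Fin
open import Data.Maybe using (nothing)
open import Data.Product using (_,_)
open import Data.Sum using (inj₁; inj₂)
open import Relation.Nullary using (¬_)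
open import Relation.Binary.PropositionalEquality as ≡ using (_≡_)
open import Algebra.Bundles using (CommutativeRing)

finSum-cong : ∀ {s} {f g : Fin s → ℕ} → (∀ i → f i ≡ g i) → finSum f ≡ finSum g
finSum-cong {zero}  f≡g = ≡.refl
finSum-cong {suc s} f≡g = ≡.cong₂ ℕ._+_ (f≡g Fin.zero) (finSum-cong (λ i → f≡g (Fin.suc i)))

module BinomialTransforms {c ℓ} (R : CommutativeRing c ℓ) where
  open CommutativeRing R
  open import Algebra.Properties.Ring ring using (-1*x≈-x; -‿distribʳ-*)
  open import Algebra.Properties.AbelianGroup +-abelianGroup
    using (ε⁻¹≈ε; ⁻¹-∙-comm; ⁻¹-anti-homo‿-; \\-leftDividesˡ; //-rightDividesˡ)
  open import Relation.Binary.Reasoning.Setoid setoid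
  open import Algebra.Solver.Ring.NaturalCoefficients commutativeSemiring (λ _ _ → nothing)

  sumTo-cong : ∀ n {f g} → (∀ l → l ≤ n → f l ≈ g l) → sumTo R n f ≈ sumTo R n g
  sumTo-cong zero    f≈g = f≈g 0 z≤n
  sumTo-cong (suc n) f≈g =
    +-cong (sumTo-cong n (λ l l≤n → f≈g l (ℕₚ.m≤n⇒m≤1+n l≤n))) (f≈g (suc n) ℕₚ.≤-refl)

  sumTo-sucˡ : ∀ n f → sumTo R (suc n) f ≈ f 0 + sumTo R n (λ l → f (suc l))
  sumTo-sucˡ zero    f = refl
  sumTo-sucˡ (suc n) f = trans (+-congʳ (sumTo-sucˡ n f)) (+-assoc _ _ _)

  sumTo-+ : ∀ n f g → sumTo R n (λ l → f l + g l) ≈ sumTo R n f + sumTo R n g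
  sumTo-+ zero    f g = refl
  sumTo-+ (suc n) f g = trans (+-congʳ (sumTo-+ n f g))
    (solve 4 (λ a b c d → (a :+ b) :+ (c :+ d) := (a :+ c) :+ (b :+ d)) refl _ _ _ _)

  sumTo-*ˡ : ∀ n x f → sumTo R n (λ l → x * f l) ≈ x * sumTo R n f
  sumTo-*ˡ zero    x f = refl
  sumTo-*ˡ (suc n) x f = trans (+-congʳ (sumTo-*ˡ n x f)) (sym (distribˡ x _ _))

  sumTo-neg : ∀ n f → sumTo R n (λ l → - f l) ≈ - sumTo R n f
  sumTo-neg zero    f = refl
  sumTo-neg (suc n) f = trans (+-congʳ (sumTo-neg n f)) (⁻¹-∙-comm _ _)

  sumTo-zero : ∀ n {f} → (∀ l → f l ≈ 0#) → sumTo R n f ≈ 0#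
  sumTo-zero zero    f≈0 = f≈0 0
  sumTo-zero (suc n) f≈0 = trans (+-cong (sumTo-zero n f≈0) (f≈0 (suc n))) (+-identityʳ 0#)

  nat-1 : nat R 1 ≈ 1#
  nat-1 = +-identityʳ 1#

  nat-+ : ∀ a b → nat R (a ℕ.+ b) ≈ nat R a + nat R b
  nat-+ zero    b = sym (+-identityˡ _)
  nat-+ (suc a) b = trans (+-congˡ (nat-+ a b)) (sym (+-assoc _ _ _))

  sign-suc : ∀ x n y → x * (sign R (suc n) * y) ≈ - (x * (sign R n * y))
  sign-suc x n y = begin
    x * ((- 1# * sign R n) * y) ≈⟨ *-congˡ (*-assoc _ _ _) ⟩
    x * (- 1# * (sign R n * y)) ≈⟨ *-congˡ (-1*x≈-x _) ⟩
    x * - (sign R n * y)        ≈⟨ -‿distribʳ-* _ _ ⟨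
    - (x * (sign R n * y))      ∎

  binomialSum : (ℕ → Carrier) → ℕ → Carrier
  binomialSum a n = sumTo R n (λ l → nat R (n C l) * a l)

  alternatingSum : (ℕ → Carrier) → ℕ → Carrier
  alternatingSum a = binomialSum (λ l → sign R l * a l)

  binomialSum-0 : ∀ a → binomialSum a 0 ≈ a 0
  binomialSum-0 a = trans (*-congʳ nat-1) (*-identityˡ _)

  binomialSum-suc : ∀ a n → binomialSum a (suc n) ≈ binomialSum a n + binomialSum (λ l → a (suc l)) n
  binomialSum-suc a n = begin
    binomialSum a (suc n)
      ≈⟨ sumTo-sucˡ n _ ⟩
    x + sumTo R n (λ l → nat R (suc n C suc l) * a (suc l))
      ≈⟨ +-congˡ (sumTo-cong n (λ l _ → pascal l)) ⟩
    x + sumTo R n (λ l → nat R (n C l) * a (suc l) + nat R (n C suc l) * a (suc l))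
      ≈⟨ +-congˡ (sumTo-+ n _ _) ⟩
    x + (y + z)
      ≈⟨ solve 3 (λ x y z → x :+ (y :+ z) := (x :+ z) :+ y) refl x y z ⟩
    (x + z) + y
      ≈⟨ +-congʳ (sumTo-sucˡ n (λ l → nat R (n C l) * a l)) ⟨
    (binomialSum a n + nat R (n C suc n) * a (suc n)) + y
      ≈⟨ +-congʳ (+-congˡ top-vanishes) ⟩
    (binomialSum a n + 0#) + y
      ≈⟨ +-congʳ (+-identityʳ _) ⟩
    binomialSum a n + y ∎
    where
    x = nat R 1 * a 0
    y = binomialSum (λ l → a (suc l)) n
    z = sumTo R n (λ l → nat R (n C suc l) * a (suc l))
    pascal : ∀ l → nat R (suc n C suc l) * a (suc l)
                   ≈ nat R (n C l) * a (suc l) + nat R (n C suc l) * a (suc l)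
    pascal l = begin
      nat R (suc n C suc l) * a (suc l)
        ≈⟨ *-congʳ (reflexive (≡.cong (nat R) (nCk+nC[k+1]≡[n+1]C[k+1] n l))) ⟨
      nat R (n C l ℕ.+ n C suc l) * a (suc l)
        ≈⟨ *-congʳ (nat-+ (n C l) (n C suc l)) ⟩
      (nat R (n C l) + nat R (n C suc l)) * a (suc l)
        ≈⟨ distribʳ _ _ _ ⟩
      nat R (n C l) * a (suc l) + nat R (n C suc l) * a (suc l) ∎
    top-vanishes : nat R (n C suc n) * a (suc n) ≈ 0#
    top-vanishes = trans (*-congʳ (reflexive (≡.cong (nat R) (k>n⇒nCk≡0 (ℕₚ.n<1+n n))))) (zeroˡ _)

  alternatingSum-cong : ∀ n {a b} → (∀ l → a l ≈ b l) → alternatingSum a n ≈ alternatingSum b n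
  alternatingSum-cong n a≈b = sumTo-cong n (λ l _ → *-congˡ (*-congˡ (a≈b l)))

  alternatingSum-0 : ∀ a → alternatingSum a 0 ≈ a 0
  alternatingSum-0 a = trans (binomialSum-0 (λ l → sign R l * a l)) (*-identityˡ _)

  alternatingSum-suc : ∀ a n →
    alternatingSum a (suc n) ≈ alternatingSum a n - alternatingSum (λ l → a (suc l)) n
  alternatingSum-suc a n = begin
    alternatingSum a (suc n)
      ≈⟨ binomialSum-suc _ n ⟩
    alternatingSum a n + binomialSum (λ l → sign R (suc l) * a (suc l)) n
      ≈⟨ +-congˡ (sumTo-cong n (λ l _ → sign-suc _ l _)) ⟩
    alternatingSum a n + sumTo R n (λ l → - (nat R (n C l) * (sign R l * a (suc l))))
      ≈⟨ +-congˡ (sumTo-neg n _) ⟩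
    alternatingSum a n - alternatingSum (λ l → a (suc l)) n ∎

  alternatingSum-linear : ∀ x a b n →
    alternatingSum (λ l → x * a l - b l) n ≈ x * alternatingSum a n - alternatingSum b n
  alternatingSum-linear x a b n = begin
    alternatingSum (λ l → x * a l - b l) n
      ≈⟨ sumTo-cong n (λ l _ → expand (nat R (n C l)) (sign R l) (a l) (b l)) ⟩
    sumTo R n (λ l → x * (nat R (n C l) * (sign R l * a l)) + - (nat R (n C l) * (sign R l * b l)))
      ≈⟨ sumTo-+ n _ _ ⟩
    sumTo R n (λ l → x * (nat R (n C l) * (sign R l * a l))) + sumTo R n (λ l → - (nat R (n C l) * (sign R l * b l)))
      ≈⟨ +-cong (sumTo-*ˡ n x _) (sumTo-neg n _) ⟩
    x * alternatingSum a n - alternatingSum b n ∎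
    where
    expand : ∀ c s u v → c * (s * (x * u - v)) ≈ x * (c * (s * u)) + - (c * (s * v))
    expand c s u v = begin
      c * (s * (x * u + - v))
        ≈⟨ solve 5 (λ c s x u w → c :* (s :* (x :* u :+ w)) := x :* (c :* (s :* u)) :+ c :* (s :* w))
                   refl c s x u (- v) ⟩
      x * (c * (s * u)) + c * (s * - v)
        ≈⟨ +-congˡ (trans (-‿distribʳ-* c _) (*-congˡ (-‿distribʳ-* s v))) ⟨
      x * (c * (s * u)) + - (c * (s * v)) ∎

  alternatingSum-zero : ∀ {a} → (∀ l → a l ≈ 0#) → ∀ n → alternatingSum a n ≈ 0#
  alternatingSum-zero a≈0 n = sumTo-zero n (λ l → trans (*-congˡ (trans (*-congˡ (a≈0 l)) (zeroʳ _))) (zeroʳ _))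

  alternatingSum-supported₀ : ∀ {a} → (∀ l → a (suc l) ≈ 0#) → ∀ n → alternatingSum a n ≈ a 0
  alternatingSum-supported₀ {a} a≈0 zero    = alternatingSum-0 a
  alternatingSum-supported₀ {a} a≈0 (suc n) = begin
    alternatingSum a (suc n)
      ≈⟨ alternatingSum-suc a n ⟩
    alternatingSum a n - alternatingSum (λ l → a (suc l)) n
      ≈⟨ +-cong (alternatingSum-supported₀ a≈0 n) (trans (-‿cong (alternatingSum-zero a≈0 n)) ε⁻¹≈ε) ⟩
    a 0 + 0#
      ≈⟨ +-identityʳ _ ⟩
    a 0 ∎

  alternatingSum-supported₀₁ : ∀ {a} → (∀ l → a (suc (suc l)) ≈ 0#) → ∀ n →
    alternatingSum a n ≈ a 0 - nat R n * a 1
  alternatingSum-supported₀₁ {a} a≈0 zero = begin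
    alternatingSum a 0  ≈⟨ alternatingSum-0 a ⟩
    a 0                 ≈⟨ +-identityʳ _ ⟨
    a 0 + 0#            ≈⟨ +-congˡ (trans (-‿cong (zeroˡ _)) ε⁻¹≈ε) ⟨
    a 0 - 0# * a 1      ∎
  alternatingSum-supported₀₁ {a} a≈0 (suc n) = begin
    alternatingSum a (suc n)
      ≈⟨ alternatingSum-suc a n ⟩
    alternatingSum a n - alternatingSum (λ l → a (suc l)) n
      ≈⟨ +-cong (alternatingSum-supported₀₁ a≈0 n) (-‿cong (alternatingSum-supported₀ a≈0 n)) ⟩
    (a 0 - nat R n * a 1) - a 1
      ≈⟨ +-assoc _ _ _ ⟩
    a 0 + (- (nat R n * a 1) + - a 1)
      ≈⟨ +-congˡ (⁻¹-∙-comm _ _) ⟩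
    a 0 - (nat R n * a 1 + a 1)
      ≈⟨ +-congˡ (-‿cong (trans (+-congʳ (*-identityˡ _)) (+-comm _ _))) ⟨
    a 0 - (1# * a 1 + nat R n * a 1)
      ≈⟨ +-congˡ (-‿cong (distribʳ _ _ _)) ⟨
    a 0 - nat R (suc n) * a 1 ∎

  alternatingSum-binomialSum : ∀ a n → alternatingSum (binomialSum a) n ≈ sign R n * a n
  alternatingSum-binomialSum a zero =
    trans (alternatingSum-0 (binomialSum a)) (trans (binomialSum-0 a) (sym (*-identityˡ _)))
  alternatingSum-binomialSum a (suc n) = begin
    alternatingSum (binomialSum a) (suc n)
      ≈⟨ alternatingSum-suc _ n ⟩
    alternatingSum (binomialSum a) n - alternatingSum (λ l → binomialSum a (suc l)) n
      ≈⟨ +-congˡ (-‿cong (alternatingSum-cong n (λ l → binomialSum-suc a l))) ⟩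
    alternatingSum (binomialSum a) n - alternatingSum (λ l → binomialSum a l + binomialSum a′ l) n
      ≈⟨ +-congˡ (-‿cong (sumTo-cong n (λ l _ → trans (*-congˡ (distribˡ _ _ _)) (distribˡ _ _ _)))) ⟩
    alternatingSum (binomialSum a) n - sumTo R n (λ l → u l + v l)
      ≈⟨ +-congˡ (trans (-‿cong (sumTo-+ n u v)) (sym (⁻¹-∙-comm _ _))) ⟩
    alternatingSum (binomialSum a) n + (- alternatingSum (binomialSum a) n + - alternatingSum (binomialSum a′) n)
      ≈⟨ \\-leftDividesˡ _ _ ⟩
    - alternatingSum (binomialSum a′) n
      ≈⟨ -‿cong (alternatingSum-binomialSum a′ n) ⟩
    - (sign R n * a (suc n))
      ≈⟨ -1*x≈-x _ ⟨
    - 1# * (sign R n * a (suc n))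
      ≈⟨ *-assoc _ _ _ ⟨
    sign R (suc n) * a (suc n) ∎
    where
    a′ = λ l → a (suc l)
    u = λ l → nat R (n C l) * (sign R l * binomialSum a l)
    v = λ l → nat R (n C l) * (sign R l * binomialSum a′ l)

  alternatingSum-shift : ∀ a K X → K ≤ X →
    binomialSum (λ l → sign R (K ∸ l) * alternatingSum a (X ∸ l)) K
    ≈ alternatingSum (λ l → a (K ℕ.+ l)) (X ∸ K)
  alternatingSum-shift a zero    X       _           =
    trans (binomialSum-0 (λ l → sign R (0 ∸ l) * alternatingSum a (X ∸ l))) (*-identityˡ _)
  alternatingSum-shift a (suc K) (suc Y) (s≤s K≤Y) = begin
    binomialSum (λ l → sign R (suc K ∸ l) * alternatingSum a (suc Y ∸ l)) (suc K)
      ≈⟨ binomialSum-suc _ K ⟩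
    binomialSum (λ l → sign R (suc K ∸ l) * alternatingSum a (suc Y ∸ l)) K
      + binomialSum (λ l → sign R (K ∸ l) * alternatingSum a (Y ∸ l)) K
      ≈⟨ +-congʳ (trans (sumTo-cong K lower-sign) (sumTo-neg K _)) ⟩
    - binomialSum (λ l → sign R (K ∸ l) * alternatingSum a (suc Y ∸ l)) K
      + binomialSum (λ l → sign R (K ∸ l) * alternatingSum a (Y ∸ l)) K
      ≈⟨ +-cong (-‿cong (alternatingSum-shift a K (suc Y) (ℕₚ.m≤n⇒m≤1+n K≤Y)))
                (alternatingSum-shift a K Y K≤Y) ⟩
    - alternatingSum aK (suc Y ∸ K) + alternatingSum aK (Y ∸ K)
      ≈⟨ +-congʳ (-‿cong (reflexive (≡.cong (alternatingSum aK) (ℕₚ.+-∸-assoc 1 K≤Y)))) ⟩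
    - alternatingSum aK (suc (Y ∸ K)) + alternatingSum aK (Y ∸ K)
      ≈⟨ +-congʳ (-‿cong (alternatingSum-suc aK (Y ∸ K))) ⟩
    - (alternatingSum aK (Y ∸ K) - alternatingSum (λ l → aK (suc l)) (Y ∸ K)) + alternatingSum aK (Y ∸ K)
      ≈⟨ trans (+-congʳ (⁻¹-anti-homo‿- _ _)) (//-rightDividesˡ _ _) ⟩
    alternatingSum (λ l → aK (suc l)) (Y ∸ K)
      ≈⟨ alternatingSum-cong (Y ∸ K) (λ l → reflexive (≡.cong a (ℕₚ.+-suc K l))) ⟩
    alternatingSum (λ l → a (suc K ℕ.+ l)) (Y ∸ K) ∎
    where
    aK = λ l → a (K ℕ.+ l)
    lower-sign : ∀ l → l ≤ K →
      nat R (K C l) * (sign R (suc K ∸ l) * alternatingSum a (suc Y ∸ l))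
      ≈ - (nat R (K C l) * (sign R (K ∸ l) * alternatingSum a (suc Y ∸ l)))
    lower-sign l l≤K = begin
      nat R (K C l) * (sign R (suc K ∸ l) * alternatingSum a (suc Y ∸ l))
        ≈⟨ reflexive (≡.cong (λ e → nat R (K C l) * (sign R e * alternatingSum a (suc Y ∸ l)))
                             (ℕₚ.+-∸-assoc 1 l≤K)) ⟩
      nat R (K C l) * (sign R (suc (K ∸ l)) * alternatingSum a (suc Y ∸ l))
        ≈⟨ sign-suc _ (K ∸ l) _ ⟩
      - (nat R (K C l) * (sign R (K ∸ l) * alternatingSum a (suc Y ∸ l))) ∎

module CarlitzNumbers {c ℓ} (R : CommutativeRing c ℓ) where
  open CommutativeRing R
  open BinomialTransforms R
  open import Algebra.Properties.Ring ring using (-1*x≈-x; -‿distribʳ-*)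
  open import Algebra.Properties.AbelianGroup +-abelianGroup
    using (ε⁻¹≈ε; ⁻¹-involutive; ⁻¹-∙-comm; ⁻¹-anti-homo‿-; ∙-cancelʳ; x∙y⁻¹≈ε⇒x≈y;
           \\-leftDividesˡ; //-rightDividesˡ)
  open import Relation.Binary.Reasoning.Setoid setoid
  open import Algebra.Solver.Ring.NaturalCoefficients commutativeSemiring (λ _ _ → nothing)

  pow-inverse : ∀ {x y} → x * y ≈ 1# → ∀ n → pow R x n * pow R y n ≈ 1#
  pow-inverse         xy≈1 zero    = *-identityˡ 1#
  pow-inverse {x} {y} xy≈1 (suc n) = begin
    (x * pow R x n) * (y * pow R y n)
      ≈⟨ solve 4 (λ x y a b → (x :* a) :* (y :* b) := (x :* y) :* (a :* b)) refl x y _ _ ⟩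
    (x * y) * (pow R x n * pow R y n)
      ≈⟨ *-cong xy≈1 (pow-inverse xy≈1 n) ⟩
    1# * 1#
      ≈⟨ *-identityˡ 1# ⟩
    1# ∎

  pow-inverse-≉1 : ∀ {x y} → x * y ≈ 1# → ∀ n → ¬ (pow R x n ≈ 1#) → ¬ (pow R y n ≈ 1#)
  pow-inverse-≉1 {x} {y} xy≈1 n xⁿ≉1 yⁿ≈1 = xⁿ≉1 (begin
    pow R x n             ≈⟨ *-identityʳ _ ⟨
    pow R x n * 1#        ≈⟨ *-congˡ yⁿ≈1 ⟨
    pow R x n * pow R y n ≈⟨ pow-inverse xy≈1 n ⟩
    1#                    ∎)

  IsField⇒*-cancelˡ : IsField R → ∀ {x u v} → ¬ (x ≈ 0#) → x * u ≈ x * v → u ≈ v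
  IsField⇒*-cancelˡ (_ , inverse) {x} {u} {v} x≉0 xu≈xv with inverse x x≉0
  ... | y , xy≈1 = begin
    u            ≈⟨ trans (*-congʳ xy≈1) (*-identityˡ u) ⟨
    (x * y) * u  ≈⟨ solve 3 (λ x y u → (x :* y) :* u := y :* (x :* u)) refl x y u ⟩
    y * (x * u)  ≈⟨ *-congˡ xu≈xv ⟩
    y * (x * v)  ≈⟨ solve 3 (λ x y v → y :* (x :* v) := (x :* y) :* v) refl x y v ⟩
    (x * y) * v  ≈⟨ trans (*-congʳ xy≈1) (*-identityˡ v) ⟩
    v            ∎

  umbralPower : Carrier → (ℕ → Carrier) → ℕ → Carrier
  umbralPower q b = binomialSum (λ j → pow R q j * b j)

  umbralPower-0 : ∀ {q β} → IsCarlitz R q β → umbralPower q β 0 ≈ 1#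
  umbralPower-0 {q} {β} (β₀≈1 , _) =
    trans (binomialSum-0 (λ j → pow R q j * β j)) (trans (*-identityˡ _) β₀≈1)

  umbralPower-rec : ∀ {q β} → IsCarlitz R q β → ∀ k → 1 ≤ k → q * umbralPower q β k ≈ δ₁ R k + β k
  umbralPower-rec {q} {β} (_ , β-rec) k 1≤k =
    trans (sym (//-rightDividesˡ (β k) _)) (+-congʳ (β-rec k 1≤k))

  umbralPower-≥2 : ∀ {q β} → IsCarlitz R q β → ∀ k → 2 ≤ k → q * umbralPower q β k ≈ β k
  umbralPower-≥2 _          (suc zero)    (s≤s ())
  umbralPower-≥2 (_ , β-rec) (suc (suc k)) _ = x∙y⁻¹≈ε⇒x≈y _ _ (β-rec (suc (suc k)) (s≤s z≤n))

  carlitz-leading : ∀ p b k →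
    p * umbralPower p b (suc k) - b (suc k)
    ≈ (pow R p (suc (suc k)) - 1#) * b (suc k) + p * sumTo R k (λ j → nat R (suc k C j) * (pow R p j * b j))
  carlitz-leading p b k = begin
    p * (A + nat R (suc k C suc k) * (P * u)) - u
      ≈⟨ +-congʳ (*-congˡ (+-congˡ (trans (*-congʳ top-coefficient) (*-identityˡ _)))) ⟩
    p * (A + P * u) - u
      ≈⟨ solve 5 (λ p A P u w → p :* (A :+ P :* u) :+ w := ((p :* P) :* u :+ w) :+ p :* A)
               refl p A P u (- u) ⟩
    ((p * P) * u - u) + p * A
      ≈⟨ +-congʳ (+-congˡ (-1*x≈-x u)) ⟨
    ((p * P) * u + - 1# * u) + p * A
      ≈⟨ +-congʳ (distribʳ u _ _) ⟨
    (p * P - 1#) * u + p * A ∎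
    where
    u = b (suc k)
    P = pow R p (suc k)
    A = sumTo R k (λ j → nat R (suc k C j) * (pow R p j * b j))
    top-coefficient : nat R (suc k C suc k) ≈ 1#
    top-coefficient = trans (reflexive (≡.cong (nat R) (nCn≡1 (suc k)))) nat-1

  isCarlitz-unique : IsField R → ∀ {p b b′} → (∀ j → 1 ≤ j → ¬ (pow R p j ≈ 1#)) →
    IsCarlitz R p b → IsCarlitz R p b′ → ∀ n → b n ≈ b′ n
  isCarlitz-unique isField {p} {b} {b′} pʲ≉1 (b₀≈1 , b-rec) (b′₀≈1 , b′-rec) n = agree n n ℕₚ.≤-refl
    where
    agree : ∀ n j → j ≤ n → b j ≈ b′ j
    agree zero    zero z≤n  = trans b₀≈1 (sym b′₀≈1)
    agree (suc n) j  j≤1+n with ℕₚ.m≤n⇒m<n∨m≡n j≤1+n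
    ... | inj₁ (s≤s j≤n) = agree n j j≤n
    ... | inj₂ ≡.refl    = IsField⇒*-cancelˡ isField leading≉0 (∙-cancelʳ _ _ _ (begin
      L * b (suc n) + p * A                   ≈⟨ carlitz-leading p b n ⟨
      p * umbralPower p b (suc n) - b (suc n)   ≈⟨ b-rec (suc n) (s≤s z≤n) ⟩
      δ₁ R (suc n)                              ≈⟨ b′-rec (suc n) (s≤s z≤n) ⟨
      p * umbralPower p b′ (suc n) - b′ (suc n) ≈⟨ carlitz-leading p b′ n ⟩
      L * b′ (suc n) + p * A′                 ≈⟨ +-congˡ (*-congˡ lower-agree) ⟨
      L * b′ (suc n) + p * A                  ∎))
      where
      L = pow R p (suc (suc n)) - 1#
      A = sumTo R n (λ j → nat R (suc n C j) * (pow R p j * b j))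
      A′ = sumTo R n (λ j → nat R (suc n C j) * (pow R p j * b′ j))
      lower-agree : A ≈ A′
      lower-agree = sumTo-cong n (λ j j≤n → *-congˡ (*-congˡ (agree n j j≤n)))
      leading≉0 : ¬ (L ≈ 0#)
      leading≉0 L≈0 = pʲ≉1 (suc (suc n)) (s≤s z≤n) (x∙y⁻¹≈ε⇒x≈y _ _ L≈0)

  isCarlitz-reciprocal : ∀ {q p β} → q * p ≈ 1# → IsCarlitz R q β →
    IsCarlitz R p (λ n → sign R n * (pow R q n * umbralPower q β n))
  isCarlitz-reciprocal {q} {p} {β} qp≈1 β-carlitz = γ₀≈1 , γ-rec
    where
    U = umbralPower q β
    γ = λ n → sign R n * (pow R q n * U n)

    γ₀≈1 : γ 0 ≈ 1#
    γ₀≈1 = trans (*-identityˡ _) (trans (*-identityˡ _) (umbralPower-0 β-carlitz))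

    umbralPower-γ : ∀ k → umbralPower p γ k ≈ sign R k * (pow R q k * β k)
    umbralPower-γ k = trans (sumTo-cong k (λ j _ → *-congˡ (cancel-powers j)))
                            (alternatingSum-binomialSum (λ j → pow R q j * β j) k)
      where
      cancel-powers : ∀ j → pow R p j * γ j ≈ sign R j * U j
      cancel-powers j = begin
        pow R p j * (sign R j * (pow R q j * U j))
          ≈⟨ solve 4 (λ a s b u → a :* (s :* (b :* u)) := s :* ((b :* a) :* u)) refl _ _ _ _ ⟩
        sign R j * ((pow R q j * pow R p j) * U j)
          ≈⟨ *-congˡ (trans (*-congʳ (pow-inverse qp≈1 j)) (*-identityˡ _)) ⟩
        sign R j * U j ∎

    γ-split : ∀ k → 1 ≤ k →
      γ k ≈ p * (sign R k * (pow R q k * β k)) + p * (sign R k * (pow R q k * δ₁ R k))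
    γ-split k 1≤k = begin
      sign R k * (pow R q k * U k)
        ≈⟨ trans (*-congʳ (trans (*-comm p q) qp≈1)) (*-identityˡ _) ⟨
      (p * q) * (sign R k * (pow R q k * U k))
        ≈⟨ solve 5 (λ p q s Q u → (p :* q) :* (s :* (Q :* u)) := p :* (s :* (Q :* (q :* u))))
                 refl p q _ _ _ ⟩
      p * (sign R k * (pow R q k * (q * U k)))
        ≈⟨ *-congˡ (*-congˡ (*-congˡ (umbralPower-rec β-carlitz k 1≤k))) ⟩
      p * (sign R k * (pow R q k * (δ₁ R k + β k)))
        ≈⟨ solve 5 (λ p s Q d b → p :* (s :* (Q :* (d :+ b))) := p :* (s :* (Q :* b)) :+ p :* (s :* (Q :* d)))
                 refl p _ _ _ _ ⟩
      p * (sign R k * (pow R q k * β k)) + p * (sign R k * (pow R q k * δ₁ R k)) ∎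

    δ-term : ∀ k → 1 ≤ k → - (p * (sign R k * (pow R q k * δ₁ R k))) ≈ δ₁ R k
    δ-term (suc zero) _ = begin
      - (p * ((- 1# * 1#) * ((q * 1#) * 1#)))
        ≈⟨ -‿cong (*-congˡ (*-cong (*-identityʳ _) (trans (*-identityʳ _) (*-identityʳ _)))) ⟩
      - (p * (- 1# * q))  ≈⟨ -‿cong (*-congˡ (-1*x≈-x q)) ⟩
      - (p * - q)         ≈⟨ -‿cong (-‿distribʳ-* p q) ⟨
      - (- (p * q))       ≈⟨ ⁻¹-involutive _ ⟩
      p * q               ≈⟨ trans (*-comm p q) qp≈1 ⟩
      1#                  ∎
    δ-term (suc (suc k)) _ =
      trans (-‿cong (trans (*-congˡ (trans (*-congˡ (zeroʳ _)) (zeroʳ _))) (zeroʳ _))) ε⁻¹≈ε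

    γ-rec : ∀ k → 1 ≤ k → p * umbralPower p γ k - γ k ≈ δ₁ R k
    γ-rec k 1≤k = begin
      p * umbralPower p γ k - γ k
        ≈⟨ +-cong (*-congˡ (umbralPower-γ k)) (-‿cong (γ-split k 1≤k)) ⟩
      W - (W + V)
        ≈⟨ trans (+-congˡ (sym (⁻¹-∙-comm W V))) (\\-leftDividesˡ W (- V)) ⟩
      - V
        ≈⟨ δ-term k 1≤k ⟩
      δ₁ R k ∎
      where
      W = p * (sign R k * (pow R q k * β k))
      V = p * (sign R k * (pow R q k * δ₁ R k))

  alternatingSum-carlitz : ∀ {q β} → IsCarlitz R q β → ∀ n →
    alternatingSum β n ≈ (nat R (n ℕ.+ 1) - q) + q * (sign R n * (pow R q n * β n))
  alternatingSum-carlitz {q} {β} β-carlitz@(β₀≈1 , β-rec) n = begin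
    alternatingSum β n
      ≈⟨ //-rightDividesˡ t (alternatingSum β n) ⟨
    (alternatingSum β n - t) + t
      ≈⟨ +-congʳ (⁻¹-anti-homo‿- t _) ⟨
    - (t - alternatingSum β n) + t
      ≈⟨ +-congʳ (-‿cong difference) ⟩
    - ((q - 1#) - nat R n) + t
      ≈⟨ +-congʳ (trans (⁻¹-anti-homo‿- _ _) (+-congˡ (⁻¹-anti-homo‿- q 1#))) ⟩
    (nat R n + (1# - q)) + t
      ≈⟨ +-congʳ (+-assoc _ _ _) ⟨
    ((nat R n + 1#) - q) + t
      ≈⟨ +-congʳ (+-congʳ (trans (nat-+ n 1) (+-congˡ nat-1))) ⟨
    (nat R (n ℕ.+ 1) - q) + t ∎
    where
    U = umbralPower q β
    t = q * (sign R n * (pow R q n * β n))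
    difference : t - alternatingSum β n ≈ (q - 1#) - nat R n
    difference = begin
      t - alternatingSum β n
        ≈⟨ +-congʳ (*-congˡ (alternatingSum-binomialSum (λ j → pow R q j * β j) n)) ⟨
      q * alternatingSum U n - alternatingSum β n
        ≈⟨ alternatingSum-linear q U β n ⟨
      alternatingSum (λ l → q * U l - β l) n
        ≈⟨ alternatingSum-supported₀₁ (λ l → β-rec (suc (suc l)) (s≤s z≤n)) n ⟩
      (q * U 0 - β 0) - nat R n * (q * U 1 - β 1)
        ≈⟨ +-cong (+-cong (trans (*-congˡ (umbralPower-0 β-carlitz)) (*-identityʳ q)) (-‿cong β₀≈1))
                  (-‿cong (trans (*-congˡ (β-rec 1 (s≤s z≤n))) (*-identityʳ _))) ⟩
      (q - 1#) - nat R n ∎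

  module _ (isField : IsField R) {q q⁻¹ : Carrier} (qq⁻¹≈1 : q * q⁻¹ ≈ 1#)
           (qʲ≉1 : ∀ j → 1 ≤ j → ¬ (pow R q j ≈ 1#)) {β β′ : ℕ → Carrier}
           (β-carlitz : IsCarlitz R q β) (β′-carlitz : IsCarlitz R q⁻¹ β′) where

    β′-reciprocal : ∀ n → β′ n ≈ sign R n * (pow R q n * umbralPower q β n)
    β′-reciprocal = isCarlitz-unique isField (λ j 1≤j → pow-inverse-≉1 qq⁻¹≈1 j (qʲ≉1 j 1≤j))
                      β′-carlitz (isCarlitz-reciprocal qq⁻¹≈1 β-carlitz)

    carlitz-summand : ∀ x → 2 ≤ x → (nat R (x ℕ.+ 1) - q) + q * q * β′ x ≈ alternatingSum β x
    carlitz-summand x 2≤x = begin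
      (nat R (x ℕ.+ 1) - q) + q * q * β′ x
        ≈⟨ +-congˡ (*-congˡ (β′-reciprocal x)) ⟩
      (nat R (x ℕ.+ 1) - q) + q * q * (sign R x * (pow R q x * umbralPower q β x))
        ≈⟨ +-congˡ (solve 4 (λ q s Q u → q :* q :* (s :* (Q :* u)) := q :* (s :* (Q :* (q :* u))))
                          refl q _ _ _) ⟩
      (nat R (x ℕ.+ 1) - q) + q * (sign R x * (pow R q x * (q * umbralPower q β x)))
        ≈⟨ +-congˡ (*-congˡ (*-congˡ (*-congˡ (umbralPower-≥2 β-carlitz x 2≤x)))) ⟩
      (nat R (x ℕ.+ 1) - q) + q * (sign R x * (pow R q x * β x))
        ≈⟨ alternatingSum-carlitz β-carlitz x ⟨
      alternatingSum β x ∎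

    carlitz-identity : ∀ K X → K ℕ.+ 1 < X →
      binomialSum (λ l → sign R (K ∸ l) * ((nat R (X ∸ l ℕ.+ 1) - q) + q * q * β′ (X ∸ l))) K
      ≈ alternatingSum (λ l → β (K ℕ.+ l)) (X ∸ K)
    carlitz-identity K X K+1<X = trans
      (sumTo-cong K (λ l l≤K → *-congˡ (*-congˡ
        (carlitz-summand (X ∸ l) (ℕₚ.≤-trans (ℕₚ.m+n≤o⇒m≤o∸n 2 2+K≤X) (ℕₚ.∸-monoʳ-≤ X l≤K))))))
      (alternatingSum-shift β K X (ℕₚ.m+n≤o⇒n≤o 2 2+K≤X))
      where
      2+K≤X : 2 ℕ.+ K ≤ X
      2+K≤X = ≡.subst (_≤ X) (≡.cong suc (ℕₚ.+-comm K 1)) K+1<X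

theorem6 : ∀ {c ℓ} (R : CommutativeRing c ℓ) → IsField R →
    let open CommutativeRing R in
    (q q⁻¹ : Carrier) → q * q⁻¹ ≈ 1# →
    (∀ j → 1 ≤ j → ¬ (pow R q j ≈ 1#)) →
    (β β' : ℕ → Carrier) → IsCarlitz R q β → IsCarlitz R q⁻¹ β' →
    (s : ℕ) → 1 ≤ s → (m n : Fin s → ℕ) (k : ℕ) →
    (finSum m ℕ.* k ℕ.+ 1 < finSum (λ i → m i ℕ.* n i)) →
    sumTo R (k ℕ.* finSum m)
      (λ l → nat R ((k ℕ.* finSum m) C l)
               * (sign R ((k ℕ.* finSum m) ∸ l)
                  * ((nat R (finSum (λ i → m i ℕ.* n i) ∸ l ℕ.+ 1) - q)
                     + q * q * β' (finSum (λ i → n i ℕ.* m i) ∸ l))))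
    ≈ sumTo R (finSum (λ i → n i ℕ.* m i) ∸ k ℕ.* finSum m)
      (λ l → nat R ((finSum (λ i → n i ℕ.* m i) ∸ k ℕ.* finSum m) C l)
               * (sign R l * β (finSum m ℕ.* k ℕ.+ l)))
theorem6 R isField q q⁻¹ qq⁻¹≈1 qʲ≉1 β β′ β-carlitz β′-carlitz s _ m n k bound
  rewrite finSum-cong (λ i → ℕₚ.*-comm (n i) (m i)) | ℕₚ.*-comm (finSum m) k =
  CarlitzNumbers.carlitz-identity R isField qq⁻¹≈1 qʲ≉1 β-carlitz β′-carlitz
    (k ℕ.* finSum m) (finSum (λ i → m i ℕ.* n i))
    bound
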